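{- Let $\pi$ be a skew-merged permutation with no central elements and $\tau$ an arbitrary skew-merged permutation. If $e_1$ and $e_2$ are embeddings of $\pi$ into $\tau$ that preserve types, then the map $f=e_1\wedge e_2$ defined by $f(x)=\mathit{outer}\{e_1(x),e_2(x)\}$ for all $x\in\pi$ is also an embedding of $\pi$ into $\tau$.
   Context: Permutations are sets of points $(i,\pi(i))$; an embedding of $\pi$ into $\tau$ is an injective map on points preserving the relative horizontal and vertical order of every pair. A permutation is skew-merged if its points can be partitioned into an increasing and a decreasing subsequence. An element of a skew-merged permutation has type NE if it plays the role of the $3$ in an occurrence of $213$; NW if it is the $3$ in an occurrence of $312$; SW if it is the $1$ in an occurrence of $132$; SE if it is the $1$ in an occurrence of $231$; central otherwise. A map preserves types if it sends each non-central element to an element of the same type. For two elements $x,y$ of the same non-central type, $x\lhd y$ means $x\neq y$ and $x$ lies strictly further out from the centre than $y$: for type SW, $x$ lies below and to the left of $y$; for NE, above and to the right; for NW, above and to the left; for SE, below and to the right. $\mathit{outer}$ of two same-type elements is the minimum with respect to $\lhd$ (the one further from the centre). -}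

module Defs where

open import Data.Nat using (ℕ)
open import Data.Fin using (Fin; _<_)
open import Data.Bool using (Bool; true; false)
open import Data.Product using (Σ; ∃; ∃-syntax; _×_; _,_)
open import Data.Sum using (_⊎_)
open import Data.Empty using (⊥)
open import Relation.Nullary using (¬_)
open import Relation.Binary.PropositionalEquality using (_≡_; _≢_)
open import Function.Definitions using (Injective)
open import Function using (_⇔_)

-- A permutation of size n: a bijection of Fin n (injective suffices on a finite set).
-- Its points are (i , perm i); we identify a point with its position i.
record Perm : Set where
  constructor mkPerm
  field
    size : ℕ
    perm : Fin size → Fin size
    perm-inj : Injective _≡_ _≡_ perm
open Perm public

Point : Perm → Set
Point π = Fin (size π)

record IsEmbedding (π τ : Perm) (e : Point π → Point τ) : Set where
  field
    injective  : Injective _≡_ _≡_ e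
    horizontal : ∀ x y → (x < y) ⇔ (e x < e y)
    vertical   : ∀ x y → (perm π x < perm π y) ⇔ (perm τ (e x) < perm τ (e y))

SkewMerged : Perm → Set
SkewMerged π = Σ (Point π → Bool) λ c →
    (∀ x y → c x ≡ true  → c y ≡ true  → x < y → perm π x < perm π y)
  × (∀ x y → c x ≡ false → c y ≡ false → x < y → perm π y < perm π x)

data Type : Set where
  NE NW SW SE : Type

HasType : (π : Perm) → Type → Point π → Set
-- 3 of a 213: positions a < b < x, values b < a < x
HasType π NE x = ∃[ a ] ∃[ b ] (a < b × b < x × perm π b < perm π a × perm π a < perm π x)
-- 3 of a 312: positions x < b < c, values b < c < x
HasType π NW x = ∃[ b ] ∃[ c ] (x < b × b < c × perm π b < perm π c × perm π c < perm π x)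
-- 1 of a 132: positions x < b < c, values x < c < b
HasType π SW x = ∃[ b ] ∃[ c ] (x < b × b < c × perm π x < perm π c × perm π c < perm π b)
-- 1 of a 231: positions a < b < x, values x < a < b
HasType π SE x = ∃[ a ] ∃[ b ] (a < b × b < x × perm π x < perm π a × perm π a < perm π b)

Central : (π : Perm) → Point π → Set
Central π x = ∀ T → ¬ HasType π T x

PreservesTypes : (π τ : Perm) → (Point π → Point τ) → Set
PreservesTypes π τ e = ∀ T x → HasType π T x → HasType τ T (e x)

-- x ◁ y for elements of type T: x ≠ y and x lies strictly further from the centre.
Further : (τ : Perm) → Type → Point τ → Point τ → Set
Further τ SW x y = x ≢ y × x < y × perm τ x < perm τ y
Further τ NE x y = x ≢ y × y < x × perm τ y < perm τ x
Further τ NW x y = x ≢ y × x < y × perm τ y < perm τ x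
Further τ SE x y = x ≢ y × y < x × perm τ x < perm τ y

-- z = outer{a, b} w.r.t. type T: z is one of a, b and is the ◁-minimum of {a, b}
-- (i.e. z ⊴ a and z ⊴ b, with ⊴ the reflexive closure of ◁).
IsOuter : (τ : Perm) → Type → Point τ → Point τ → Point τ → Set
IsOuter τ T a b z = (z ≡ a ⊎ z ≡ b)
                  × (z ≡ a ⊎ Further τ T z a)
                  × (z ≡ b ⊎ Further τ T z b)

IsMeet : (π τ : Perm) → (e₁ e₂ f : Point π → Point τ) → Set
IsMeet π τ e₁ e₂ f = ∀ T x → HasType π T x → IsOuter τ T (e₁ x) (e₂ x) (f x)

-- In a skew-merged permutation the four types fill four quadrants: the
-- increasing colour class carries the SW and NE elements, the decreasing one
-- the NW and SE elements, and each typed element has an element of the other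
-- class on its inner side. Hence left types (SW, NW) lie strictly left of
-- right types (NE, SE), south types strictly below north types, and the
-- elements of one type form a ◁-chain, so outer{e₁(x), e₂(x)} exists.
-- Let x precede y along an axis and say f(x) = e(x), where {e, e′} = {e₁, e₂}.
-- If the type of x points to the low end of that axis, e(x) lies at or
-- before e′(x) and so precedes both images of y, hence f(y). Otherwise, by
-- the separation of types, the type of y points to the high end too, and
-- symmetrically f(y) lies at or after both images of x.
module Submission where

open import Defs
open import Data.Bool using (Bool; true; false; not)
open import Data.Empty using (⊥-elim)
open import Data.Nat using (ℕ)
open import Data.Fin using (Fin; toℕ; _<_; _≤_)
open import Data.Fin.Properties using (_≟_; _<?_; <-cmp; <-irrefl; <-asym; <-trans; ≤-refl; any?)
open import Data.Nat.Properties using (≤-<-trans; <-≤-trans; <⇒≤; <⇒≱; ≮⇒≥; ≰⇒>; module ≤-Reasoning)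
open import Data.Product using (Σ; ∃-syntax; _×_; _,_; proj₁; proj₂; curry)
open import Data.Sum using (_⊎_; inj₁; inj₂)
open import Function using (id; _∘_; mk⇔; Equivalence)
open import Function.Definitions using (Injective)
open import Relation.Binary.Definitions using (tri<; tri≈; tri>)
open import Relation.Binary.PropositionalEquality using (_≡_; _≢_; refl; sym; trans; cong; cong₂; subst)
open import Relation.Nullary using (¬_; Dec; yes; no)
open import Relation.Nullary.Decidable using (_×-dec_; decidable-stable)

data Axis : Set where
  horizontal vertical : Axis

coord : (σ : Perm) → Axis → Point σ → Fin (size σ)
coord σ horizontal x = x
coord σ vertical   x = perm σ x

data Side : Set where
  low high : Side

-- The end of an axis towards which elements of a type point.
side : Type → Axis → Side
side SW _          = low
side NE _          = high
side NW horizontal = low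
side NW vertical   = high
side SE horizontal = high
side SE vertical   = low

quadrant : Side → Side → Type
quadrant low  low  = SW
quadrant low  high = NW
quadrant high high = NE
quadrant high low  = SE

quadrant-side : ∀ T → quadrant (side T horizontal) (side T vertical) ≡ T
quadrant-side SW = refl
quadrant-side NW = refl
quadrant-side NE = refl
quadrant-side SE = refl

Beyond : ∀ {n} → Side → Fin n → Fin n → Set
Beyond low  i j = i < j
Beyond high i j = j < i

further⇒beyond : ∀ {τ} T d {a b} → Further τ T a b → Beyond (side T d) (coord τ d a) (coord τ d b)
further⇒beyond SW horizontal (_ , p , _) = p
further⇒beyond SW vertical   (_ , _ , p) = p
further⇒beyond NE horizontal (_ , p , _) = p
further⇒beyond NE vertical   (_ , _ , p) = p
further⇒beyond NW horizontal (_ , p , _) = p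
further⇒beyond NW vertical   (_ , _ , p) = p
further⇒beyond SE horizontal (_ , p , _) = p
further⇒beyond SE vertical   (_ , _ , p) = p

FurtherOrEqual : (τ : Perm) → Type → Point τ → Point τ → Set
FurtherOrEqual τ T a b = a ≡ b ⊎ Further τ T a b

furtherOrEqual⇒≤ : ∀ {τ T} d {a b} → side T d ≡ low → FurtherOrEqual τ T a b → coord τ d a ≤ coord τ d b
furtherOrEqual⇒≤ d _ (inj₁ refl) = ≤-refl
furtherOrEqual⇒≤ {T = T} d sT (inj₂ a◁b) = <⇒≤ (subst (λ s → Beyond s _ _) sT (further⇒beyond T d a◁b))

furtherOrEqual⇒≥ : ∀ {τ T} d {a b} → side T d ≡ high → FurtherOrEqual τ T a b → coord τ d b ≤ coord τ d a
furtherOrEqual⇒≥ d _ (inj₁ refl) = ≤-refl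
furtherOrEqual⇒≥ {T = T} d sT (inj₂ a◁b) = <⇒≤ (subst (λ s → Beyond s _ _) sT (further⇒beyond T d a◁b))

PreservesOrders : (π τ : Perm) → (Point π → Point τ) → Set
PreservesOrders π τ f = ∀ d {x y} → coord π d x < coord π d y → coord τ d (f x) < coord τ d (f y)

isEmbedding⇒preservesOrders : ∀ {π τ f} → IsEmbedding π τ f → PreservesOrders π τ f
isEmbedding⇒preservesOrders E horizontal {x} {y} = Equivalence.to (IsEmbedding.horizontal E x y)
isEmbedding⇒preservesOrders E vertical   {x} {y} = Equivalence.to (IsEmbedding.vertical E x y)

strictlyIncreasing⇒injective : ∀ {m n} {f : Fin m → Fin n} → (∀ {x y} → x < y → f x < f y) → Injective _≡_ _≡_ f
strictlyIncreasing⇒injective mono {x} {y} fx≡fy with <-cmp x y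
... | tri< x<y _ _ = ⊥-elim (<-irrefl fx≡fy (mono x<y))
... | tri≈ _ x≡y _ = x≡y
... | tri> _ _ y<x = ⊥-elim (<-irrefl (sym fx≡fy) (mono y<x))

strictlyIncreasing-reflects : ∀ {A : Set} {m n} (u : A → Fin m) (v : A → Fin n) → Injective _≡_ _≡_ u
  → (∀ {x y} → u x < u y → v x < v y) → ∀ {x y} → v x < v y → u x < u y
strictlyIncreasing-reflects u v u-inj mono {x} {y} vx<vy with <-cmp (u x) (u y)
... | tri< ux<uy _ _ = ux<uy
... | tri≈ _ ux≡uy _ = ⊥-elim (<-irrefl (cong v (u-inj ux≡uy)) vx<vy)
... | tri> _ _ uy<ux = ⊥-elim (<-asym vx<vy (mono uy<ux))

preservesOrders⇒isEmbedding : ∀ {π τ} f → PreservesOrders π τ f → IsEmbedding π τ f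
preservesOrders⇒isEmbedding {π} {τ} f mono = record
  { injective  = strictlyIncreasing⇒injective (mono horizontal)
  ; horizontal = λ x y → mk⇔ (mono horizontal {x} {y})
      (strictlyIncreasing-reflects id f id (mono horizontal))
  ; vertical   = λ x y → mk⇔ (mono vertical {x} {y})
      (strictlyIncreasing-reflects (perm π) (perm τ ∘ f) (perm-inj π) (mono vertical))
  }

hasType? : ∀ σ T x → Dec (HasType σ T x)
hasType? σ NE x = any? λ a → any? λ b →
  (a <? b) ×-dec (b <? x) ×-dec (perm σ b <? perm σ a) ×-dec (perm σ a <? perm σ x)
hasType? σ NW x = any? λ b → any? λ c →
  (x <? b) ×-dec (b <? c) ×-dec (perm σ b <? perm σ c) ×-dec (perm σ c <? perm σ x)
hasType? σ SW x = any? λ b → any? λ c →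
  (x <? b) ×-dec (b <? c) ×-dec (perm σ x <? perm σ c) ×-dec (perm σ c <? perm σ b)
hasType? σ SE x = any? λ a → any? λ b →
  (a <? b) ×-dec (b <? x) ×-dec (perm σ x <? perm σ a) ×-dec (perm σ a <? perm σ b)

type? : ∀ σ x → Dec (∃[ T ] HasType σ T x)
type? σ x with hasType? σ SW x | hasType? σ NW x | hasType? σ NE x | hasType? σ SE x
... | yes h | _     | _     | _     = yes (SW , h)
... | no _  | yes h | _     | _     = yes (NW , h)
... | no _  | no _  | yes h | _     = yes (NE , h)
... | no _  | no _  | no _  | yes h = yes (SE , h)
... | no ¬SW | no ¬NW | no ¬NE | no ¬SE =
  no λ { (SW , h) → ¬SW h ; (NW , h) → ¬NW h ; (NE , h) → ¬NE h ; (SE , h) → ¬SE h }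

nonCentral⇒typed : ∀ σ x → ¬ Central σ x → ∃[ T ] HasType σ T x
nonCentral⇒typed σ x ¬central = decidable-stable (type? σ x) (¬central ∘ curry)

colourOf : Type → Bool
colourOf SW = true
colourOf NE = true
colourOf NW = false
colourOf SE = false

module SkewMergedProperties {σ : Perm} (sm : SkewMerged σ) where

  colour : Point σ → Bool
  colour = proj₁ sm

  increasing : ∀ a b → colour a ≡ true → colour b ≡ true → a < b → perm σ a < perm σ b
  increasing = proj₁ (proj₂ sm)

  decreasing : ∀ a b → colour a ≡ false → colour b ≡ false → a < b → perm σ b < perm σ a
  decreasing = proj₂ (proj₂ sm)

  P : Point σ → ℕ
  P x = toℕ (perm σ x)

  increasing-reflects : ∀ {a b} → colour a ≡ true → colour b ≡ true → perm σ a < perm σ b → a < b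
  increasing-reflects {a} {b} ca cb Pa<Pb with <-cmp a b
  ... | tri< a<b _ _ = a<b
  ... | tri≈ _ refl _ = ⊥-elim (<-irrefl refl Pa<Pb)
  ... | tri> _ _ b<a = ⊥-elim (<-asym Pa<Pb (increasing b a cb ca b<a))

  decreasing-reflects : ∀ {a b} → colour a ≡ false → colour b ≡ false → perm σ b < perm σ a → a < b
  decreasing-reflects {a} {b} ca cb Pb<Pa with <-cmp a b
  ... | tri< a<b _ _ = a<b
  ... | tri≈ _ refl _ = ⊥-elim (<-irrefl refl Pb<Pa)
  ... | tri> _ _ b<a = ⊥-elim (<-asym Pb<Pa (decreasing b a cb ca b<a))

  increasing-monotone : ∀ {a b} → colour a ≡ true → colour b ≡ true → a ≤ b → perm σ a ≤ perm σ b
  increasing-monotone ca cb a≤b = ≮⇒≥ λ Pb<Pa → <⇒≱ (increasing-reflects cb ca Pb<Pa) a≤b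

  decreasing-antitone : ∀ {a b} → colour a ≡ false → colour b ≡ false → a ≤ b → perm σ b ≤ perm σ a
  decreasing-antitone ca cb a≤b = ≮⇒≥ λ Pa<Pb → <⇒≱ (decreasing-reflects cb ca Pa<Pb) a≤b

  anchor : ∀ T {x} → HasType σ T x → colour x ≡ colourOf T
    × ∃[ a ] (colour a ≡ not (colourOf T)
              × Beyond (side T horizontal) x a × Beyond (side T vertical) (perm σ x) (perm σ a))
  anchor SW {x} (b , c , x<b , b<c , Px<Pc , Pc<Pb) with colour x in cx | colour b in cb | colour c in cc
  ... | _     | true  | true  = ⊥-elim (<-asym (increasing b c cb cc b<c) Pc<Pb)
  ... | false | true  | false = ⊥-elim (<-asym (decreasing x c cx cc (<-trans x<b b<c)) Px<Pc)
  ... | false | false | _     = ⊥-elim (<-asym (decreasing x b cx cb x<b) (<-trans Px<Pc Pc<Pb))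
  ... | true  | false | _     = refl , b , cb , x<b , <-trans Px<Pc Pc<Pb
  ... | true  | true  | false = refl , c , cc , <-trans x<b b<c , Px<Pc
  anchor NE {x} (a , b , a<b , b<x , Pb<Pa , Pa<Px) with colour x in cx | colour a in ca | colour b in cb
  ... | _     | true  | true  = ⊥-elim (<-asym (increasing a b ca cb a<b) Pb<Pa)
  ... | false | false | _     = ⊥-elim (<-asym (decreasing a x ca cx (<-trans a<b b<x)) Pa<Px)
  ... | false | true  | false = ⊥-elim (<-asym (decreasing b x cb cx b<x) (<-trans Pb<Pa Pa<Px))
  ... | true  | false | _     = refl , a , ca , <-trans a<b b<x , Pa<Px
  ... | true  | true  | false = refl , b , cb , b<x , <-trans Pb<Pa Pa<Px
  anchor NW {x} (b , c , x<b , b<c , Pb<Pc , Pc<Px) with colour x in cx | colour b in cb | colour c in cc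
  ... | _     | false | false = ⊥-elim (<-asym (decreasing b c cb cc b<c) Pb<Pc)
  ... | true  | true  | _     = ⊥-elim (<-asym (increasing x b cx cb x<b) (<-trans Pb<Pc Pc<Px))
  ... | true  | false | true  = ⊥-elim (<-asym (increasing x c cx cc (<-trans x<b b<c)) Pc<Px)
  ... | false | true  | _     = refl , b , cb , x<b , <-trans Pb<Pc Pc<Px
  ... | false | false | true  = refl , c , cc , <-trans x<b b<c , Pc<Px
  anchor SE {x} (a , b , a<b , b<x , Px<Pa , Pa<Pb) with colour x in cx | colour a in ca | colour b in cb
  ... | _     | false | false = ⊥-elim (<-asym (decreasing a b ca cb a<b) Pa<Pb)
  ... | true  | true  | _     = ⊥-elim (<-asym (increasing a x ca cx (<-trans a<b b<x)) Px<Pa)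
  ... | true  | false | true  = ⊥-elim (<-asym (increasing b x cb cx b<x) (<-trans Px<Pa Pa<Pb))
  ... | false | true  | _     = refl , a , ca , <-trans a<b b<x , Px<Pa
  ... | false | false | true  = refl , b , cb , b<x , <-trans Px<Pa Pa<Pb

  open ≤-Reasoning

  separatedHorizontally : ∀ {T U x y} → side T horizontal ≡ low → side U horizontal ≡ high
    → HasType σ T x → HasType σ U y → x < y
  separatedHorizontally {SW} {NE} {x} {y} _ _ hx hy with anchor SW hx | anchor NE hy
  ... | cx , d , cd , x<d , Px<Pd | cy , d′ , cd′ , d′<y , Pd′<Py = ≰⇒> λ y≤x → begin-contradiction
    P d′ <⟨ Pd′<Py ⟩
    P y  ≤⟨ increasing-monotone cy cx y≤x ⟩
    P x  <⟨ Px<Pd ⟩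
    P d  <⟨ decreasing d′ d cd′ cd (<-trans (<-≤-trans d′<y y≤x) x<d) ⟩
    P d′ ∎
  separatedHorizontally {SW} {SE} {x} {y} _ _ hx hy with anchor SW hx | anchor SE hy
  ... | cx , d , cd , x<d , Px<Pd | cy , i , ci , i<y , Py<Pi = ≰⇒> λ y≤x → begin-contradiction
    P x <⟨ Px<Pd ⟩
    P d <⟨ decreasing y d cy cd (≤-<-trans y≤x x<d) ⟩
    P y <⟨ Py<Pi ⟩
    P i <⟨ increasing i x ci cx (<-≤-trans i<y y≤x) ⟩
    P x ∎
  separatedHorizontally {NW} {NE} {x} {y} _ _ hx hy with anchor NW hx | anchor NE hy
  ... | cx , i , ci , x<i , Pi<Px | cy , d , cd , d<y , Pd<Py = ≰⇒> λ y≤x → begin-contradiction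
    P x <⟨ decreasing d x cd cx (<-≤-trans d<y y≤x) ⟩
    P d <⟨ Pd<Py ⟩
    P y <⟨ increasing y i cy ci (≤-<-trans y≤x x<i) ⟩
    P i <⟨ Pi<Px ⟩
    P x ∎
  separatedHorizontally {NW} {SE} {x} {y} _ _ hx hy with anchor NW hx | anchor SE hy
  ... | cx , i , ci , x<i , Pi<Px | cy , i′ , ci′ , i′<y , Py<Pi′ = ≰⇒> λ y≤x → begin-contradiction
    P i  <⟨ Pi<Px ⟩
    P x  ≤⟨ decreasing-antitone cy cx y≤x ⟩
    P y  <⟨ Py<Pi′ ⟩
    P i′ <⟨ increasing i′ i ci′ ci (<-trans (<-≤-trans i′<y y≤x) x<i) ⟩
    P i  ∎
  separatedHorizontally {NE} () _ _ _
  separatedHorizontally {SE} () _ _ _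
  separatedHorizontally {U = SW} _ () _ _
  separatedHorizontally {U = NW} _ () _ _

  separatedVertically : ∀ {T U x y} → side T vertical ≡ low → side U vertical ≡ high
    → HasType σ T x → HasType σ U y → perm σ x < perm σ y
  separatedVertically {SW} {NW} {x} {y} _ _ hx hy with anchor SW hx | anchor NW hy
  ... | cx , d , cd , x<d , Px<Pd | cy , i , ci , y<i , Pi<Py = ≰⇒> λ Py≤Px → begin-contradiction
    toℕ x <⟨ x<d ⟩
    toℕ d <⟨ decreasing-reflects cd cy (≤-<-trans Py≤Px Px<Pd) ⟩
    toℕ y <⟨ y<i ⟩
    toℕ i <⟨ increasing-reflects ci cx (<-≤-trans Pi<Py Py≤Px) ⟩
    toℕ x ∎
  separatedVertically {SW} {NE} {x} {y} _ _ hx hy with anchor SW hx | anchor NE hy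
  ... | cx , d , cd , x<d , Px<Pd | cy , d′ , cd′ , d′<y , Pd′<Py = ≰⇒> λ Py≤Px →
    let x<y = begin-strict
          toℕ x  <⟨ x<d ⟩
          toℕ d  <⟨ decreasing-reflects cd cd′ (<-trans (<-≤-trans Pd′<Py Py≤Px) Px<Pd) ⟩
          toℕ d′ <⟨ d′<y ⟩
          toℕ y  ∎
    in <⇒≱ (increasing x y cx cy x<y) Py≤Px
  separatedVertically {SE} {NW} {x} {y} _ _ hx hy with anchor SE hx | anchor NW hy
  ... | cx , i , ci , i<x , Px<Pi | cy , i′ , ci′ , y<i′ , Pi′<Py = ≰⇒> λ Py≤Px →
    let y<x = begin-strict
          toℕ y  <⟨ y<i′ ⟩
          toℕ i′ <⟨ increasing-reflects ci′ ci (<-trans (<-≤-trans Pi′<Py Py≤Px) Px<Pi) ⟩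
          toℕ i  <⟨ i<x ⟩
          toℕ x  ∎
    in <⇒≱ (decreasing y x cy cx y<x) Py≤Px
  separatedVertically {SE} {NE} {x} {y} _ _ hx hy with anchor SE hx | anchor NE hy
  ... | cx , i , ci , i<x , Px<Pi | cy , d , cd , d<y , Pd<Py = ≰⇒> λ Py≤Px → begin-contradiction
    toℕ i <⟨ i<x ⟩
    toℕ x <⟨ decreasing-reflects cx cd (<-≤-trans Pd<Py Py≤Px) ⟩
    toℕ d <⟨ d<y ⟩
    toℕ y <⟨ increasing-reflects cy ci (≤-<-trans Py≤Px Px<Pi) ⟩
    toℕ i ∎
  separatedVertically {NW} () _ _ _
  separatedVertically {NE} () _ _ _
  separatedVertically {U = SW} _ () _ _
  separatedVertically {U = SE} _ () _ _

  separated : ∀ d {T U x y} → side T d ≡ low → side U d ≡ high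
    → HasType σ T x → HasType σ U y → coord σ d x < coord σ d y
  separated horizontal = separatedHorizontally
  separated vertical   = separatedVertically

  sides-agree : ∀ d {T U x} → HasType σ T x → HasType σ U x → side T d ≡ side U d
  sides-agree d {T} {U} hT hU with side T d in sT | side U d in sU
  ... | low  | low  = refl
  ... | high | high = refl
  ... | low  | high = ⊥-elim (<-irrefl refl (separated d sT sU hT hU))
  ... | high | low  = ⊥-elim (<-irrefl refl (separated d sU sT hU hT))

  types-exclusive : ∀ {T U x} → HasType σ T x → HasType σ U x → T ≡ U
  types-exclusive {T} {U} hT hU =
    trans (sym (quadrant-side T))
          (trans (cong₂ quadrant (sides-agree horizontal hT hU) (sides-agree vertical hT hU))
                 (quadrant-side U))

  further-total : ∀ T {a b} → HasType σ T a → HasType σ T b → a ≢ b → Further σ T a b ⊎ Further σ T b a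
  further-total T {a} {b} ha hb a≢b with <-cmp a b | proj₁ (anchor T ha) | proj₁ (anchor T hb)
  ... | tri≈ _ a≡b _ | _ | _ = ⊥-elim (a≢b a≡b)
  further-total SW ha hb a≢b | tri< a<b _ _ | ca | cb = inj₁ (a≢b , a<b , increasing _ _ ca cb a<b)
  further-total SW ha hb a≢b | tri> _ _ b<a | ca | cb = inj₂ (a≢b ∘ sym , b<a , increasing _ _ cb ca b<a)
  further-total NE ha hb a≢b | tri< a<b _ _ | ca | cb = inj₂ (a≢b ∘ sym , a<b , increasing _ _ ca cb a<b)
  further-total NE ha hb a≢b | tri> _ _ b<a | ca | cb = inj₁ (a≢b , b<a , increasing _ _ cb ca b<a)
  further-total NW ha hb a≢b | tri< a<b _ _ | ca | cb = inj₁ (a≢b , a<b , decreasing _ _ ca cb a<b)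
  further-total NW ha hb a≢b | tri> _ _ b<a | ca | cb = inj₂ (a≢b ∘ sym , b<a , decreasing _ _ cb ca b<a)
  further-total SE ha hb a≢b | tri< a<b _ _ | ca | cb = inj₂ (a≢b ∘ sym , a<b , decreasing _ _ ca cb a<b)
  further-total SE ha hb a≢b | tri> _ _ b<a | ca | cb = inj₁ (a≢b , b<a , decreasing _ _ cb ca b<a)

open SkewMergedProperties using (separated; types-exclusive; further-total)

outer-exists : ∀ {τ} → SkewMerged τ → ∀ T {a b} → HasType τ T a → HasType τ T b
  → Σ (Point τ) (IsOuter τ T a b)
outer-exists sm T {a} {b} ha hb with a ≟ b
... | yes refl = a , inj₁ refl , inj₁ refl , inj₁ refl
... | no a≢b with further-total sm T ha hb a≢b
...   | inj₁ a◁b = a , inj₁ refl , inj₁ refl , inj₂ a◁b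
...   | inj₂ b◁a = b , inj₂ refl , inj₂ b◁a , inj₁ refl

outers-related : ∀ {τ T U} (R : Point τ → Point τ → Set) {a₁ a₂ b₁ b₂ z w}
  → R a₁ b₁ → R a₂ b₂
  → (FurtherOrEqual τ T a₁ a₂ → FurtherOrEqual τ U b₂ b₁ → R a₁ b₂)
  → (FurtherOrEqual τ T a₂ a₁ → FurtherOrEqual τ U b₁ b₂ → R a₂ b₁)
  → IsOuter τ T a₁ a₂ z → IsOuter τ U b₁ b₂ w → R z w
outers-related R r₁₁ r₂₂ r₁₂ r₂₁ (inj₁ refl , _ , _)    (inj₁ refl , _ , _)    = r₁₁
outers-related R r₁₁ r₂₂ r₁₂ r₂₁ (inj₁ refl , _ , z⊴a₂) (inj₂ refl , w⊴b₁ , _) = r₁₂ z⊴a₂ w⊴b₁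
outers-related R r₁₁ r₂₂ r₁₂ r₂₁ (inj₂ refl , z⊴a₁ , _) (inj₁ refl , _ , w⊴b₂) = r₂₁ z⊴a₁ w⊴b₂
outers-related R r₁₁ r₂₂ r₁₂ r₂₁ (inj₂ refl , _ , _)    (inj₂ refl , _ , _)    = r₂₂

outward-images-ordered : ∀ {π τ} → SkewMerged π → ∀ {e e′} → IsEmbedding π τ e → IsEmbedding π τ e′
  → ∀ d {T U x y} → HasType π T x → HasType π U y → coord π d x < coord π d y
  → FurtherOrEqual τ T (e x) (e′ x) → FurtherOrEqual τ U (e′ y) (e y)
  → coord τ d (e x) < coord τ d (e′ y)
outward-images-ordered smπ E E′ d {T} {U} hx hy x<y ex⊴e′x e′y⊴ey with side T d in sT | side U d in sU
... | low  | _    = ≤-<-trans (furtherOrEqual⇒≤ d sT ex⊴e′x) (isEmbedding⇒preservesOrders E′ d x<y)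
... | high | high = <-≤-trans (isEmbedding⇒preservesOrders E d x<y) (furtherOrEqual⇒≥ d sU e′y⊴ey)
... | high | low  = ⊥-elim (<-asym x<y (separated smπ d sU sT hy hx))

meet-exists : ∀ {π τ} → SkewMerged π → SkewMerged τ → ∀ {e₁ e₂}
  → PreservesTypes π τ e₁ → PreservesTypes π τ e₂ → Σ (Point π → Point τ) (IsMeet π τ e₁ e₂)
meet-exists {π} {τ} smπ smτ {e₁} {e₂} P₁ P₂ = proj₁ ∘ outerAt , λ T x → proj₂ (outerAt x) T
  where
  outerAt : ∀ x → Σ (Point τ) λ z → ∀ T → HasType π T x → IsOuter τ T (e₁ x) (e₂ x) z
  outerAt x with type? π x
  ... | no untyped = e₁ x , λ T h → ⊥-elim (untyped (T , h))
  ... | yes (T , h) with outer-exists smτ T (P₁ T x h) (P₂ T x h)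
  ...   | z , z-outer = z , λ U h′ → subst (λ V → IsOuter τ V (e₁ x) (e₂ x) z) (types-exclusive smπ h h′) z-outer

meet-isEmbedding : ∀ {π τ} → SkewMerged π → (∀ x → ¬ Central π x) → ∀ {e₁ e₂}
  → IsEmbedding π τ e₁ → IsEmbedding π τ e₂ → ∀ f → IsMeet π τ e₁ e₂ f → IsEmbedding π τ f
meet-isEmbedding {π} {τ} smπ nc E₁ E₂ f meet = preservesOrders⇒isEmbedding f f-preservesOrders
  where
  f-preservesOrders : PreservesOrders π τ f
  f-preservesOrders d {x} {y} x<y with nonCentral⇒typed π x (nc x) | nonCentral⇒typed π y (nc y)
  ... | T , hx | U , hy =
    outers-related (λ a b → coord τ d a < coord τ d b)
      (isEmbedding⇒preservesOrders E₁ d x<y) (isEmbedding⇒preservesOrders E₂ d x<y)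
      (outward-images-ordered smπ E₁ E₂ d hx hy x<y) (outward-images-ordered smπ E₂ E₁ d hx hy x<y)
      (meet T x hx) (meet U y hy)

lemma11 : (π τ : Perm) → SkewMerged π → SkewMerged τ
        → (∀ x → ¬ Central π x)
        → (e₁ e₂ : Point π → Point τ)
        → IsEmbedding π τ e₁ → IsEmbedding π τ e₂
        → PreservesTypes π τ e₁ → PreservesTypes π τ e₂
        → Σ (Point π → Point τ) (IsMeet π τ e₁ e₂)
          × (∀ f → IsMeet π τ e₁ e₂ f → IsEmbedding π τ f)
lemma11 π τ smπ smτ nc e₁ e₂ E₁ E₂ P₁ P₂ =
  meet-exists smπ smτ P₁ P₂ , meet-isEmbedding smπ nc E₁ E₂
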